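{- The rules $(\land_r)$, $(\lor_r)$ and $(\exists_r)$ are height-preserving invertible in $\mathsf{LNIF}$: whenever the conclusion of an instance of one of these rules has an $\mathsf{LNIF}$-derivation of height $h$, each premise of that instance has an $\mathsf{LNIF}$-derivation of height at most $h$.
   Context: The height of a derivation is the number of sequents on its longest branch from the end sequent to an initial sequent. Formulae are first-order over $\bot,\land,\lor,\supset,\forall,\exists$; in sequents bound variables $x,y,\dots$ are distinct from parameters $a,b,\dots$, which occupy all free positions; $A[a/x]$ replaces free occurrences of $x$ by $a$; $p(\vec a)$ is an atomic formula with parameters $\vec a$. A linear nested sequent is $\Gamma_1\vdash\Delta_1 /\!/ \cdots /\!/ \Gamma_n\vdash\Delta_n$ ($n\ge1$), each $\Gamma_i,\Delta_i$ a finite, possibly empty, multiset of formulae (a component). In rule schemas, $\mathcal{G},\mathcal{H},\mathcal{F}$ denote possibly empty sequences of components. $\mathsf{LNIF}$ has the rules (from premise(s) infer conclusion): Initial: $(id_1)$ $\mathcal{G}/\!/\Gamma,p(\vec a)\vdash p(\vec a),\Delta/\!/\mathcal{H}$; $(id_2)$ $\mathcal{G}/\!/\Gamma_1,p(\vec a)\vdash\Delta_1/\!/\mathcal{H}/\!/\Gamma_2\vdash p(\vec a),\Delta_2/\!/\mathcal{F}$; $(\bot_l)$ $\mathcal{G}/\!/\Gamma,\bot\vdash\Delta/\!/\mathcal{H}$. $(\land_l)$: from $\mathcal{G}/\!/\Gamma,A,B\vdash\Delta/\!/\mathcal{H}$ infer $\mathcal{G}/\!/\Gamma,A\land B\vdash\Delta/\!/\mathcal{H}$.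 $(\lor_r)$: from $\mathcal{G}/\!/\Gamma\vdash\Delta,A,B/\!/\mathcal{H}$ infer $\mathcal{G}/\!/\Gamma\vdash\Delta,A\lor B/\!/\mathcal{H}$. $(\land_r)$: from $\mathcal{G}/\!/\Gamma\vdash\Delta,A/\!/\mathcal{H}$ and $\mathcal{G}/\!/\Gamma\vdash\Delta,B/\!/\mathcal{H}$ infer $\mathcal{G}/\!/\Gamma\vdash\Delta,A\land B/\!/\mathcal{H}$. $(\lor_l)$: from $\mathcal{G}/\!/\Gamma,A\vdash\Delta/\!/\mathcal{H}$ and $\mathcal{G}/\!/\Gamma,B\vdash\Delta/\!/\mathcal{H}$ infer $\mathcal{G}/\!/\Gamma,A\lor B\vdash\Delta/\!/\mathcal{H}$. $(\supset_{r1})$: from $\mathcal{G}/\!/\Gamma\vdash\Delta/\!/A\vdash B$ infer $\mathcal{G}/\!/\Gamma\vdash\Delta,A\supset B$. $(\supset_l)$: from $\mathcal{G}/\!/\Gamma,B\vdash\Delta/\!/\mathcal{H}$ and $\mathcal{G}/\!/\Gamma,A\supset B\vdash A,\Delta/\!/\mathcal{H}$ infer $\mathcal{G}/\!/\Gamma,A\supset B\vdash\Delta/\!/\mathcal{H}$. $(lift)$: from $\mathcal{G}/\!/\Gamma_1,A\vdash\Delta_1/\!/\Gamma_2,A\vdash\Delta_2/\!/\mathcal{H}$ infer $\mathcal{G}/\!/\Gamma_1,A\vdash\Delta_1/\!/\Gamma_2\vdash\Delta_2/\!/\mathcal{H}$. $(\forall_l)$: from $\mathcal{G}/\!/\Gamma,A[a/x],\forall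 xA\vdash\Delta/\!/\mathcal{H}$ infer $\mathcal{G}/\!/\Gamma,\forall xA\vdash\Delta/\!/\mathcal{H}$ ($a$ any parameter). $(\forall_{r1})$: from $\mathcal{G}/\!/\Gamma\vdash\Delta/\!/\ \vdash A[a/x]$ infer $\mathcal{G}/\!/\Gamma\vdash\Delta,\forall xA$. $(\exists_l)$: from $\mathcal{G}/\!/\Gamma,A[a/x]\vdash\Delta/\!/\mathcal{H}$ infer $\mathcal{G}/\!/\Gamma,\exists xA\vdash\Delta/\!/\mathcal{H}$. $(\exists_r)$: from $\mathcal{G}/\!/\Gamma\vdash A[a/x],\exists xA,\Delta/\!/\mathcal{H}$ infer $\mathcal{G}/\!/\Gamma\vdash\exists xA,\Delta/\!/\mathcal{H}$ ($a$ any parameter). $(\supset_{r2})$: from $\mathcal{G}/\!/\Gamma_1\vdash\Delta_1/\!/A\vdash B/\!/\Gamma_2\vdash\Delta_2/\!/\mathcal{H}$ and $\mathcal{G}/\!/\Gamma_1\vdash\Delta_1/\!/\Gamma_2\vdash\Delta_2,A\supset B/\!/\mathcal{H}$ infer $\mathcal{G}/\!/\Gamma_1\vdash\Delta_1,A\supset B/\!/\Gamma_2\vdash\Delta_2/\!/\mathcal{H}$. $(\forall_{r2})$: from $\mathcal{G}/\!/\Gamma_1\vdash\Delta_1/\!/\ \vdash A[a/x]/\!/\Gamma_2\vdash\Delta_2/\!/\mathcal{H}$ and $\mathcal{G}/\!/\Gamma_1\vdash\Delta_1/\!/\Gamma_2\vdash\Delta_2,\forall xA/\!/\mathcal{H}$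 infer $\mathcal{G}/\!/\Gamma_1\vdash\Delta_1,\forall xA/\!/\Gamma_2\vdash\Delta_2/\!/\mathcal{H}$. In $(\forall_{r1}),(\exists_l),(\forall_{r2})$, $a$ is an eigenvariable (does not occur in the conclusion). -}

module Defs where

open import Data.Nat using (ℕ; zero; suc; _≟_; _⊔_; _≤_)
open import Data.List using (List; []; _∷_; _++_; map; concatMap)
open import Data.List.Membership.Propositional using (_∈_; _∉_)
open import Data.List.Relation.Unary.All using (All)
open import Data.List.Relation.Binary.Pointwise using (Pointwise)
open import Data.List.Relation.Binary.Permutation.Propositional using (_↭_)
open import Data.Product using (_×_; _,_; Σ)
open import Relation.Nullary using (yes; no)

data Tm : Set where
  var : ℕ → Tm
  par : ℕ → Tm

infixr 6 _∧'_
infixr 5 _∨'_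
infixr 4 _⊃_

data Fm : Set where
  atom : ℕ → List Tm → Fm
  ⊥'   : Fm
  _∧'_ : Fm → Fm → Fm
  _∨'_ : Fm → Fm → Fm
  _⊃_  : Fm → Fm → Fm
  ∀'   : ℕ → Fm → Fm
  ∃'   : ℕ → Fm → Fm

patom : ℕ → List ℕ → Fm
patom p as = atom p (map par as)

substTm : ℕ → ℕ → Tm → Tm
substTm a x (var y) with x ≟ y
... | yes _ = par a
... | no  _ = var y
substTm a x (par b) = par b

subst : ℕ → ℕ → Fm → Fm
subst a x (atom p ts) = atom p (map (substTm a x) ts)
subst a x ⊥'          = ⊥'
subst a x (A ∧' B)    = subst a x A ∧' subst a x B
subst a x (A ∨' B)    = subst a x A ∨' subst a x B
subst a x (A ⊃ B)     = subst a x A ⊃ subst a x B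
subst a x (∀' y A) with x ≟ y
... | yes _ = ∀' y A
... | no  _ = ∀' y (subst a x A)
subst a x (∃' y A) with x ≟ y
... | yes _ = ∃' y A
... | no  _ = ∃' y (subst a x A)

parsTm : Tm → List ℕ
parsTm (var _) = []
parsTm (par a) = a ∷ []

pars : Fm → List ℕ
pars (atom p ts) = concatMap parsTm ts
pars ⊥'          = []
pars (A ∧' B)    = pars A ++ pars B
pars (A ∨' B)    = pars A ++ pars B
pars (A ⊃ B)     = pars A ++ pars B
pars (∀' _ A)    = pars A
pars (∃' _ A)    = pars A

data ClosedTm (bs : List ℕ) : Tm → Set where
  cvar : ∀ {x} → x ∈ bs → ClosedTm bs (var x)
  cpar : ∀ {a} → ClosedTm bs (par a)

data ClosedUnder (bs : List ℕ) : Fm → Set where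
  catom : ∀ {p ts} → All (ClosedTm bs) ts → ClosedUnder bs (atom p ts)
  c⊥    : ClosedUnder bs ⊥'
  c∧    : ∀ {A B} → ClosedUnder bs A → ClosedUnder bs B → ClosedUnder bs (A ∧' B)
  c∨    : ∀ {A B} → ClosedUnder bs A → ClosedUnder bs B → ClosedUnder bs (A ∨' B)
  c⊃    : ∀ {A B} → ClosedUnder bs A → ClosedUnder bs B → ClosedUnder bs (A ⊃ B)
  c∀    : ∀ {x A} → ClosedUnder (x ∷ bs) A → ClosedUnder bs (∀' x A)
  c∃    : ∀ {x A} → ClosedUnder (x ∷ bs) A → ClosedUnder bs (∃' x A)

Closed : Fm → Set
Closed = ClosedUnder []

-- A component Γ ⊢ Δ (multisets represented as lists, taken up to permutation)
Comp : Set
Comp = List Fm × List Fm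

LNS : Set
LNS = List Comp

_≈c_ : Comp → Comp → Set
(Γ , Δ) ≈c (Γ' , Δ') = (Γ ↭ Γ') × (Δ ↭ Δ')

_≈_ : LNS → LNS → Set
_≈_ = Pointwise _≈c_

parsC : Comp → List ℕ
parsC (Γ , Δ) = concatMap pars Γ ++ concatMap pars Δ

parsS : LNS → List ℕ
parsS S = concatMap parsC S

ClosedS : LNS → Set
ClosedS S = All (λ c → All Closed (Data.Product.proj₁ c) × All Closed (Data.Product.proj₂ c)) S

data Inst0 : LNS → Set where
  id₁ : ∀ G Γ Δ H p as → Inst0 (G ++ (patom p as ∷ Γ , patom p as ∷ Δ) ∷ H)
  id₂ : ∀ G Γ₁ Δ₁ H Γ₂ Δ₂ F p as →
        Inst0 (G ++ (patom p as ∷ Γ₁ , Δ₁) ∷ H ++ (Γ₂ , patom p as ∷ Δ₂) ∷ F)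
  ⊥l  : ∀ G Γ Δ H → Inst0 (G ++ (⊥' ∷ Γ , Δ) ∷ H)

data Inst1 : LNS → LNS → Set where
  ∧l   : ∀ G Γ Δ H A B →
         Inst1 (G ++ (A ∷ B ∷ Γ , Δ) ∷ H) (G ++ ((A ∧' B) ∷ Γ , Δ) ∷ H)
  ∨r   : ∀ G Γ Δ H A B →
         Inst1 (G ++ (Γ , A ∷ B ∷ Δ) ∷ H) (G ++ (Γ , (A ∨' B) ∷ Δ) ∷ H)
  ⊃r₁  : ∀ G Γ Δ A B →
         Inst1 (G ++ (Γ , Δ) ∷ (A ∷ [] , B ∷ []) ∷ []) (G ++ (Γ , (A ⊃ B) ∷ Δ) ∷ [])
  lift : ∀ G Γ₁ Δ₁ Γ₂ Δ₂ H A →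
         Inst1 (G ++ (A ∷ Γ₁ , Δ₁) ∷ (A ∷ Γ₂ , Δ₂) ∷ H)
               (G ++ (A ∷ Γ₁ , Δ₁) ∷ (Γ₂ , Δ₂) ∷ H)
  ∀l   : ∀ G Γ Δ H x A a →
         Inst1 (G ++ (subst a x A ∷ ∀' x A ∷ Γ , Δ) ∷ H) (G ++ (∀' x A ∷ Γ , Δ) ∷ H)
  ∀r₁  : ∀ G Γ Δ x A a → a ∉ parsS (G ++ (Γ , ∀' x A ∷ Δ) ∷ []) →
         Inst1 (G ++ (Γ , Δ) ∷ ([] , subst a x A ∷ []) ∷ []) (G ++ (Γ , ∀' x A ∷ Δ) ∷ [])
  ∃l   : ∀ G Γ Δ H x A a → a ∉ parsS (G ++ (∃' x A ∷ Γ , Δ) ∷ H) →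
         Inst1 (G ++ (subst a x A ∷ Γ , Δ) ∷ H) (G ++ (∃' x A ∷ Γ , Δ) ∷ H)
  ∃r   : ∀ G Γ Δ H x A a →
         Inst1 (G ++ (Γ , subst a x A ∷ ∃' x A ∷ Δ) ∷ H) (G ++ (Γ , ∃' x A ∷ Δ) ∷ H)

data Inst2 : LNS → LNS → LNS → Set where
  ∧r  : ∀ G Γ Δ H A B →
        Inst2 (G ++ (Γ , A ∷ Δ) ∷ H) (G ++ (Γ , B ∷ Δ) ∷ H) (G ++ (Γ , (A ∧' B) ∷ Δ) ∷ H)
  ∨l  : ∀ G Γ Δ H A B →
        Inst2 (G ++ (A ∷ Γ , Δ) ∷ H) (G ++ (B ∷ Γ , Δ) ∷ H) (G ++ ((A ∨' B) ∷ Γ , Δ) ∷ H)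
  ⊃l  : ∀ G Γ Δ H A B →
        Inst2 (G ++ (B ∷ Γ , Δ) ∷ H) (G ++ ((A ⊃ B) ∷ Γ , A ∷ Δ) ∷ H)
              (G ++ ((A ⊃ B) ∷ Γ , Δ) ∷ H)
  ⊃r₂ : ∀ G Γ₁ Δ₁ Γ₂ Δ₂ H A B →
        Inst2 (G ++ (Γ₁ , Δ₁) ∷ (A ∷ [] , B ∷ []) ∷ (Γ₂ , Δ₂) ∷ H)
              (G ++ (Γ₁ , Δ₁) ∷ (Γ₂ , (A ⊃ B) ∷ Δ₂) ∷ H)
              (G ++ (Γ₁ , (A ⊃ B) ∷ Δ₁) ∷ (Γ₂ , Δ₂) ∷ H)
  ∀r₂ : ∀ G Γ₁ Δ₁ Γ₂ Δ₂ H x A a →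
        a ∉ parsS (G ++ (Γ₁ , ∀' x A ∷ Δ₁) ∷ (Γ₂ , Δ₂) ∷ H) →
        Inst2 (G ++ (Γ₁ , Δ₁) ∷ ([] , subst a x A ∷ []) ∷ (Γ₂ , Δ₂) ∷ H)
              (G ++ (Γ₁ , Δ₁) ∷ (Γ₂ , ∀' x A ∷ Δ₂) ∷ H)
              (G ++ (Γ₁ , ∀' x A ∷ Δ₁) ∷ (Γ₂ , Δ₂) ∷ H)

-- LNIF derivations: each node is a rule instance whose conclusion equals
-- the derived sequent up to permutation inside components (multisets).

data Der : LNS → Set where
  leaf : ∀ {S C}     → Inst0 C     → S ≈ C → Der S
  node₁ : ∀ {S P C}   → Inst1 P C   → S ≈ C → Der P → Der S
  node₂ : ∀ {S P Q C} → Inst2 P Q C → S ≈ C → Der P → Der Q → Der S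

height : ∀ {S} → Der S → ℕ
height (leaf _ _)        = 1
height (node₁ _ _ d)     = suc (height d)
height (node₂ _ _ d₁ d₂) = suc (height d₁ ⊔ height d₂)

DerAtMost : ℕ → LNS → Set
DerAtMost h P = Σ (Der P) (λ d → height d ≤ h)

-- By induction on a height bound h, for a formula X in a succedent that is to be replaced by Ys.
-- If the last rule is principal on X, its premises yield the inverted sequent directly; for ∃r,
-- whose premise still contains ∃xA, one more application of the inductive hypothesis is needed.
-- Otherwise every rule of LNIF is parametric in the succedent multiset that holds X: the inductive
-- hypothesis inverts each premise at the corresponding place and the same rule is applied again.
-- The eigenvariable of ∃l, ∀r₁, ∀r₂ may occur in Ys, so it is first renamed to a fresh parameter,
-- which costs no height because renaming parameters is height-preserving.

module Submission where

open import Defs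
open import Data.Nat using (ℕ; zero; suc; _≟_; s≤s; z≤n)
open import Data.Nat.Properties using (≤-refl; ≤-trans; m≤m⊔n; m≤n⊔m; ⊔-lub; <-irrefl; m≤n⇒m≤1+n)
open import Data.List using (List; []; _∷_; _++_; [_]; map; concatMap)
open import Data.List.Properties
  using (++-assoc; ++-identityʳ; map-++; map-cong; map-id; map-∘; ++-conicalʳ; ∷-injective; concatMap-++)
open import Data.List.Extrema.Nat using (max; xs≤max)
open import Data.List.Membership.Propositional using (_∈_; _∉_)
open import Data.List.Membership.Propositional.Properties
  using (∈-++⁺ˡ; ∈-++⁺ʳ; ∈-++⁻; ∈-∃++; ∈-concatMap⁺; ∈-concatMap⁻)
open import Data.List.Relation.Unary.Any using (here)
open import Data.List.Relation.Unary.All as All using (All; []; _∷_)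
import Data.List.Relation.Unary.All.Properties as All
open import Data.List.Relation.Binary.Pointwise as Pointwise using (Pointwise; []; _∷_)
open import Data.List.Relation.Binary.Permutation.Propositional using (_↭_; ↭-refl; ↭-sym; ↭-trans; prep; swap)
open import Data.List.Relation.Binary.Permutation.Propositional.Properties
  using (++⁺ˡ; shift; shifts; drop-mid; ∈-resp-↭; Any-resp-↭; map⁺; ↭-empty-inv; ↭-singleton-inv)
open import Data.Product using (_×_; _,_; ∃; ∃₂; proj₁; proj₂)
open import Data.Sum using (_⊎_; inj₁; inj₂)
open import Data.Empty using (⊥-elim)
open import Data.Unit using (⊤; tt)
open import Function using (id; _∘_)
open import Relation.Nullary using (yes; no; ¬_)
open import Relation.Binary.PropositionalEquality using (_≡_; _≢_; refl; sym; trans; cong; cong₂)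
import Relation.Binary.PropositionalEquality as ≡

≈c-refl : ∀ {c} → c ≈c c
≈c-refl = ↭-refl , ↭-refl

≈c-sym : ∀ {c c'} → c ≈c c' → c' ≈c c
≈c-sym (p , q) = ↭-sym p , ↭-sym q

≈c-trans : ∀ {c c' c''} → c ≈c c' → c' ≈c c'' → c ≈c c''
≈c-trans (p , q) (p' , q') = ↭-trans p p' , ↭-trans q q'

≈-refl : ∀ {S} → S ≈ S
≈-refl = Pointwise.refl ≈c-refl

≈-sym : ∀ {S S'} → S ≈ S' → S' ≈ S
≈-sym = Pointwise.symmetric ≈c-sym

≈-trans : ∀ {S S' S''} → S ≈ S' → S' ≈ S'' → S ≈ S''
≈-trans = Pointwise.transitive ≈c-trans

≡⇒≈ : ∀ {S S'} → S ≡ S' → S ≈ S'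
≡⇒≈ refl = ≈-refl

data Rule : List LNS → LNS → Set where
  axiom  : ∀ {C} → Inst0 C → Rule [] C
  unary  : ∀ {P C} → Inst1 P C → Rule [ P ] C
  binary : ∀ {P Q C} → Inst2 P Q C → Rule (P ∷ Q ∷ []) C

record Step (h : ℕ) (S : LNS) : Set where
  constructor step
  field
    {premises}  : List LNS
    {conclusion} : LNS
    rule        : Rule premises conclusion
    matches     : S ≈ conclusion
    derivations : All (DerAtMost h) premises

infer : ∀ {h S} → Step h S → DerAtMost (suc h) S
infer (step (axiom i) e []) = leaf i e , s≤s z≤n
infer (step (unary i) e ((d , hd) ∷ [])) = node₁ i e d , s≤s hd
infer (step (binary i) e ((d₁ , hd₁) ∷ (d₂ , hd₂) ∷ [])) = node₂ i e d₁ d₂ , s≤s (⊔-lub hd₁ hd₂)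

lastStep : ∀ {h S} → DerAtMost (suc h) S → Step h S
lastStep (leaf i e , _) = step (axiom i) e []
lastStep (node₁ i e d , s≤s hd) = step (unary i) e ((d , hd) ∷ [])
lastStep (node₂ i e d₁ d₂ , s≤s hd) =
  step (binary i) e ((d₁ , ≤-trans (m≤m⊔n _ _) hd) ∷ (d₂ , ≤-trans (m≤n⊔m _ _) hd) ∷ [])

DerAtMost-resp-≈ : ∀ {h S S'} → S ≈ S' → DerAtMost h S' → DerAtMost h S
DerAtMost-resp-≈ e (leaf i e' , hd) = leaf i (≈-trans e e') , hd
DerAtMost-resp-≈ e (node₁ i e' d , hd) = node₁ i (≈-trans e e') d , hd
DerAtMost-resp-≈ e (node₂ i e' d₁ d₂ , hd) = node₂ i (≈-trans e e') d₁ d₂ , hd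

DerAtMost-resp-≡ : ∀ {h S S'} → S ≡ S' → DerAtMost h S' → DerAtMost h S
DerAtMost-resp-≡ refl D = D

DerAtMost-suc : ∀ {h S} → DerAtMost h S → DerAtMost (suc h) S
DerAtMost-suc (d , hd) = d , m≤n⇒m≤1+n hd

∷↭++ : ∀ {A : Set} {x : A} {xs} ys {zs} → x ∷ xs ↭ ys ++ zs →
  (∃ λ ys' → ys ↭ x ∷ ys' × xs ↭ ys' ++ zs) ⊎ (∃ λ zs' → zs ↭ x ∷ zs' × xs ↭ ys ++ zs')
∷↭++ {x = x} {xs} ys {zs} p with ∈-++⁻ ys (∈-resp-↭ p (here refl))
... | inj₁ x∈ys with as , bs , refl ← ∈-∃++ x∈ys =
  inj₁ (as ++ bs , shift x as bs ,
        ≡.subst (xs ↭_) (sym (++-assoc as bs zs))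
          (drop-mid [] as (≡.subst (x ∷ xs ↭_) (++-assoc as (x ∷ bs) zs) p)))
... | inj₂ x∈zs with as , bs , refl ← ∈-∃++ x∈zs =
  inj₂ (as ++ bs , shift x as bs ,
        ≡.subst (xs ↭_) (++-assoc ys as bs)
          (drop-mid [] (ys ++ as) (≡.subst (x ∷ xs ↭_) (sym (++-assoc ys as (x ∷ bs))) p)))

↭-[]-∷ : ∀ {A : Set} {x : A} {xs} → ¬ ([] ↭ x ∷ xs)
↭-[]-∷ p with () ← ↭-empty-inv (↭-sym p)

↭-[-]-∷ : ∀ {A : Set} {x y : A} {xs} → [ y ] ↭ x ∷ xs → x ≡ y
↭-[-]-∷ p with refl ← ↭-singleton-inv (↭-sym p) = refl

fresh : List ℕ → ℕ
fresh L = suc (max 0 L)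

fresh-∉ : ∀ L → fresh L ∉ L
fresh-∉ L a∈L = <-irrefl refl (All.lookup (xs≤max 0 L) a∈L)

∉-++⁻ˡ : ∀ {A : Set} {a : A} xs {ys} → a ∉ xs ++ ys → a ∉ xs
∉-++⁻ˡ xs a∉ a∈ = a∉ (∈-++⁺ˡ a∈)

∉-++⁻ʳ : ∀ {A : Set} {a : A} xs {ys} → a ∉ xs ++ ys → a ∉ ys
∉-++⁻ʳ xs a∉ a∈ = a∉ (∈-++⁺ʳ xs a∈)

concatMap-pars-resp-↭ : ∀ {a Γ Γ'} → Γ ↭ Γ' → a ∈ concatMap pars Γ → a ∈ concatMap pars Γ'
concatMap-pars-resp-↭ p = ∈-concatMap⁺ pars ∘ Any-resp-↭ p ∘ ∈-concatMap⁻ pars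

parsC-resp-≈c : ∀ {a c c'} → c ≈c c' → a ∈ parsC c → a ∈ parsC c'
parsC-resp-≈c {c = Γ , Δ} (Γ↭ , Δ↭) a∈ with ∈-++⁻ (concatMap pars Γ) a∈
... | inj₁ a∈Γ = ∈-++⁺ˡ (concatMap-pars-resp-↭ Γ↭ a∈Γ)
... | inj₂ a∈Δ = ∈-++⁺ʳ _ (concatMap-pars-resp-↭ Δ↭ a∈Δ)

parsS-resp-≈ : ∀ {a S S'} → S ≈ S' → a ∈ parsS S → a ∈ parsS S'
parsS-resp-≈ S≈S' = ∈-concatMap⁺ parsC ∘ Pointwise.Any-resp-Pointwise parsC-resp-≈c S≈S' ∘ ∈-concatMap⁻ parsC

-- Renaming parameters preserves height

infix 8 _[_↦_]

_[_↦_] : (ℕ → ℕ) → ℕ → ℕ → ℕ → ℕ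
(f [ a ↦ e ]) b with b ≟ a
... | yes _ = e
... | no  _ = f b

[↦]-≡ : ∀ f a e → (f [ a ↦ e ]) a ≡ e
[↦]-≡ f a e with a ≟ a
... | yes _ = refl
... | no a≢a = ⊥-elim (a≢a refl)

[↦]-≢ : ∀ f {a e b} → b ≢ a → (f [ a ↦ e ]) b ≡ f b
[↦]-≢ f {a} {b = b} b≢a with b ≟ a
... | yes b≡a = ⊥-elim (b≢a b≡a)
... | no  _   = refl

mapTm : (ℕ → ℕ) → Tm → Tm
mapTm f (var x) = var x
mapTm f (par a) = par (f a)

mapFm : (ℕ → ℕ) → Fm → Fm
mapFm f (atom p ts) = atom p (map (mapTm f) ts)
mapFm f ⊥'          = ⊥'
mapFm f (A ∧' B)    = mapFm f A ∧' mapFm f B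
mapFm f (A ∨' B)    = mapFm f A ∨' mapFm f B
mapFm f (A ⊃ B)     = mapFm f A ⊃ mapFm f B
mapFm f (∀' x A)    = ∀' x (mapFm f A)
mapFm f (∃' x A)    = ∃' x (mapFm f A)

mapComp : (ℕ → ℕ) → Comp → Comp
mapComp f (Γ , Δ) = map (mapFm f) Γ , map (mapFm f) Δ

mapSeq : (ℕ → ℕ) → LNS → LNS
mapSeq f = map (mapComp f)

mapTm-substTm : ∀ f a x t → mapTm f (substTm a x t) ≡ substTm (f a) x (mapTm f t)
mapTm-substTm f a x (var y) with x ≟ y
... | yes _ = refl
... | no  _ = refl
mapTm-substTm f a x (par b) = refl

mapFm-subst : ∀ f a x A → mapFm f (subst a x A) ≡ subst (f a) x (mapFm f A)
mapFm-subst f a x (atom p ts) =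
  cong (atom p) (trans (sym (map-∘ ts)) (trans (map-cong (mapTm-substTm f a x) ts) (map-∘ ts)))
mapFm-subst f a x ⊥'       = refl
mapFm-subst f a x (A ∧' B) = cong₂ _∧'_ (mapFm-subst f a x A) (mapFm-subst f a x B)
mapFm-subst f a x (A ∨' B) = cong₂ _∨'_ (mapFm-subst f a x A) (mapFm-subst f a x B)
mapFm-subst f a x (A ⊃ B)  = cong₂ _⊃_ (mapFm-subst f a x A) (mapFm-subst f a x B)
mapFm-subst f a x (∀' y A) with x ≟ y
... | yes _ = refl
... | no  _ = cong (∀' y) (mapFm-subst f a x A)
mapFm-subst f a x (∃' y A) with x ≟ y
... | yes _ = refl
... | no  _ = cong (∃' y) (mapFm-subst f a x A)

mapFm-patom : ∀ f p as → mapFm f (patom p as) ≡ patom p (map f as)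
mapFm-patom f p as = cong (atom p) (trans (sym (map-∘ as)) (map-∘ as))

mapFm-id : ∀ A → mapFm id A ≡ A
mapFm-id (atom p ts) = cong (atom p) (trans (map-cong mapTm-id ts) (map-id ts))
  where mapTm-id : ∀ t → mapTm id t ≡ t
        mapTm-id (var _) = refl
        mapTm-id (par _) = refl
mapFm-id ⊥'       = refl
mapFm-id (A ∧' B) = cong₂ _∧'_ (mapFm-id A) (mapFm-id B)
mapFm-id (A ∨' B) = cong₂ _∨'_ (mapFm-id A) (mapFm-id B)
mapFm-id (A ⊃ B)  = cong₂ _⊃_ (mapFm-id A) (mapFm-id B)
mapFm-id (∀' x A) = cong (∀' x) (mapFm-id A)
mapFm-id (∃' x A) = cong (∃' x) (mapFm-id A)

map-mapFm-id : ∀ Γ → map (mapFm id) Γ ≡ Γ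
map-mapFm-id Γ = trans (map-cong mapFm-id Γ) (map-id Γ)

mapSeq-id : ∀ S → mapSeq id S ≡ S
mapSeq-id S = trans (map-cong (λ (Γ , Δ) → cong₂ _,_ (map-mapFm-id Γ) (map-mapFm-id Δ)) S) (map-id S)

map-cong-∉ : ∀ {B : Set} (P : B → List ℕ) {a} {g h : B → B} →
  (∀ y → a ∉ P y → g y ≡ h y) → ∀ ys → a ∉ concatMap P ys → map g ys ≡ map h ys
map-cong-∉ P g≡h []       _  = refl
map-cong-∉ P g≡h (y ∷ ys) a∉ = cong₂ _∷_ (g≡h y (∉-++⁻ˡ (P y) a∉)) (map-cong-∉ P g≡h ys (∉-++⁻ʳ (P y) a∉))

mapFm-[↦]-∉ : ∀ f {a e} A → a ∉ pars A → mapFm (f [ a ↦ e ]) A ≡ mapFm f A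
mapFm-[↦]-∉ f (atom p ts) a∉ = cong (atom p) (map-cong-∉ parsTm mapTm-[↦]-∉ ts a∉)
  where mapTm-[↦]-∉ : ∀ {a e} t → a ∉ parsTm t → mapTm (f [ a ↦ e ]) t ≡ mapTm f t
        mapTm-[↦]-∉ (var _) _  = refl
        mapTm-[↦]-∉ (par b) a∉ = cong par ([↦]-≢ f (λ b≡a → a∉ (here (sym b≡a))))
mapFm-[↦]-∉ f ⊥'       a∉ = refl
mapFm-[↦]-∉ f (A ∧' B) a∉ = cong₂ _∧'_ (mapFm-[↦]-∉ f A (∉-++⁻ˡ (pars A) a∉)) (mapFm-[↦]-∉ f B (∉-++⁻ʳ (pars A) a∉))
mapFm-[↦]-∉ f (A ∨' B) a∉ = cong₂ _∨'_ (mapFm-[↦]-∉ f A (∉-++⁻ˡ (pars A) a∉)) (mapFm-[↦]-∉ f B (∉-++⁻ʳ (pars A) a∉))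
mapFm-[↦]-∉ f (A ⊃ B)  a∉ = cong₂ _⊃_ (mapFm-[↦]-∉ f A (∉-++⁻ˡ (pars A) a∉)) (mapFm-[↦]-∉ f B (∉-++⁻ʳ (pars A) a∉))
mapFm-[↦]-∉ f (∀' x A) a∉ = cong (∀' x) (mapFm-[↦]-∉ f A a∉)
mapFm-[↦]-∉ f (∃' x A) a∉ = cong (∃' x) (mapFm-[↦]-∉ f A a∉)

mapFms-[↦]-∉ : ∀ f {a e} Γ → a ∉ concatMap pars Γ → map (mapFm (f [ a ↦ e ])) Γ ≡ map (mapFm f) Γ
mapFms-[↦]-∉ f = map-cong-∉ pars (mapFm-[↦]-∉ f)

mapSeq-[↦]-∉ : ∀ f {a e} S → a ∉ parsS S → mapSeq (f [ a ↦ e ]) S ≡ mapSeq f S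
mapSeq-[↦]-∉ f = map-cong-∉ parsC λ (Γ , Δ) a∉ →
  cong₂ _,_ (mapFms-[↦]-∉ f Γ (∉-++⁻ˡ (concatMap pars Γ) a∉)) (mapFms-[↦]-∉ f Δ (∉-++⁻ʳ (concatMap pars Γ) a∉))

mapFm-subst-[↦] : ∀ f {a e} x A → a ∉ pars A → mapFm (f [ a ↦ e ]) (subst a x A) ≡ subst e x (mapFm f A)
mapFm-subst-[↦] f {a} {e} x A a∉ =
  trans (mapFm-subst _ a x A) (cong₂ (λ b B → subst b x B) ([↦]-≡ f a e) (mapFm-[↦]-∉ f A a∉))

∉-parsS-component : ∀ {a} G Γ Δ H → a ∉ parsS (G ++ (Γ , Δ) ∷ H) →
  a ∉ parsS G × a ∉ concatMap pars Γ × a ∉ concatMap pars Δ × a ∉ parsS H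
∉-parsS-component {a} G Γ Δ H a∉ =
  ∉-++⁻ˡ (parsS G) a∉' , ∉-++⁻ˡ (concatMap pars Γ) a∉ΓΔ ,
  ∉-++⁻ʳ (concatMap pars Γ) a∉ΓΔ , ∉-++⁻ʳ (parsC (Γ , Δ)) a∉ΓΔH
  where
  a∉' = ≡.subst (a ∉_) (concatMap-++ parsC G ((Γ , Δ) ∷ H)) a∉
  a∉ΓΔH = ∉-++⁻ʳ (parsS G) a∉'
  a∉ΓΔ = ∉-++⁻ˡ (parsC (Γ , Δ)) a∉ΓΔH

cong-component : ∀ {G G' : LNS} {Γ Γ' Δ Δ' H H'} →
  G ≡ G' → Γ ≡ Γ' → Δ ≡ Δ' → H ≡ H' → G ++ (Γ , Δ) ∷ H ≡ G' ++ (Γ' , Δ') ∷ H'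
cong-component refl refl refl refl = refl

mapSeq-∃l-premise : ∀ f {e} G Γ Δ H x A a → a ∉ parsS (G ++ (∃' x A ∷ Γ , Δ) ∷ H) →
  mapSeq (f [ a ↦ e ]) (G ++ (subst a x A ∷ Γ , Δ) ∷ H)
    ≡ mapSeq f G ++ (subst e x (mapFm f A) ∷ map (mapFm f) Γ , map (mapFm f) Δ) ∷ mapSeq f H
mapSeq-∃l-premise f G Γ Δ H x A a a∉
  with a∉G , a∉AΓ , a∉Δ , a∉H ← ∉-parsS-component G (∃' x A ∷ Γ) Δ H a∉ =
  trans (map-++ _ G _)
    (cong-component (mapSeq-[↦]-∉ f G a∉G)
      (cong₂ _∷_ (mapFm-subst-[↦] f x A (∉-++⁻ˡ (pars A) a∉AΓ)) (mapFms-[↦]-∉ f Γ (∉-++⁻ʳ (pars A) a∉AΓ)))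
      (mapFms-[↦]-∉ f Δ a∉Δ) (mapSeq-[↦]-∉ f H a∉H))

mapSeq-∀r₁-premise : ∀ f {e} G Γ Δ x A a → a ∉ parsS (G ++ (Γ , ∀' x A ∷ Δ) ∷ []) →
  mapSeq (f [ a ↦ e ]) (G ++ (Γ , Δ) ∷ ([] , subst a x A ∷ []) ∷ [])
    ≡ mapSeq f G ++ (map (mapFm f) Γ , map (mapFm f) Δ) ∷ ([] , subst e x (mapFm f A) ∷ []) ∷ []
mapSeq-∀r₁-premise f G Γ Δ x A a a∉
  with a∉G , a∉Γ , a∉AΔ , _ ← ∉-parsS-component G Γ (∀' x A ∷ Δ) [] a∉ =
  trans (map-++ _ G _)
    (cong-component (mapSeq-[↦]-∉ f G a∉G) (mapFms-[↦]-∉ f Γ a∉Γ) (mapFms-[↦]-∉ f Δ (∉-++⁻ʳ (pars A) a∉AΔ))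
      (cong (λ B → ([] , B ∷ []) ∷ []) (mapFm-subst-[↦] f x A (∉-++⁻ˡ (pars A) a∉AΔ))))

mapSeq-∀r₂-premise : ∀ f {e} G Γ₁ Δ₁ Γ₂ Δ₂ H x A a →
  a ∉ parsS (G ++ (Γ₁ , ∀' x A ∷ Δ₁) ∷ (Γ₂ , Δ₂) ∷ H) →
  mapSeq (f [ a ↦ e ]) (G ++ (Γ₁ , Δ₁) ∷ ([] , subst a x A ∷ []) ∷ (Γ₂ , Δ₂) ∷ H)
    ≡ mapSeq f G ++ (map (mapFm f) Γ₁ , map (mapFm f) Δ₁) ∷ ([] , subst e x (mapFm f A) ∷ [])
                  ∷ mapSeq f ((Γ₂ , Δ₂) ∷ H)
mapSeq-∀r₂-premise f G Γ₁ Δ₁ Γ₂ Δ₂ H x A a a∉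
  with a∉G , a∉Γ₁ , a∉AΔ₁ , a∉H ← ∉-parsS-component G Γ₁ (∀' x A ∷ Δ₁) ((Γ₂ , Δ₂) ∷ H) a∉ =
  trans (map-++ _ G _)
    (cong-component (mapSeq-[↦]-∉ f G a∉G) (mapFms-[↦]-∉ f Γ₁ a∉Γ₁) (mapFms-[↦]-∉ f Δ₁ (∉-++⁻ʳ (pars A) a∉AΔ₁))
      (cong₂ (λ B K → ([] , B ∷ []) ∷ K) (mapFm-subst-[↦] f x A (∉-++⁻ˡ (pars A) a∉AΔ₁))
        (mapSeq-[↦]-∉ f ((Γ₂ , Δ₂) ∷ H) a∉H)))

mapSeq-resp-≈ : ∀ f {S S'} → S ≈ S' → mapSeq f S ≈ mapSeq f S'
mapSeq-resp-≈ f = Pointwise.map⁺ (mapComp f) (mapComp f) ∘ Pointwise.map (λ (Γ↭ , Δ↭) → map⁺ _ Γ↭ , map⁺ _ Δ↭)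

-- At an eigenvariable rule with eigenvariable a, the premise is renamed by f [ a ↦ e ] for an e
-- fresh for the renamed conclusion.
DerAtMost-mapSeq : ∀ h f {S} → DerAtMost h S → DerAtMost h (mapSeq f S)
DerAtMost-mapSeq zero f (leaf _ _ , ())
DerAtMost-mapSeq zero f (node₁ _ _ _ , ())
DerAtMost-mapSeq zero f (node₂ _ _ _ _ , ())
DerAtMost-mapSeq (suc h) f D = infer (mapStep (lastStep D))
  where
  F = mapFm f
  Fs = map (mapFm f)
  FS = mapSeq f

  rec : ∀ {S} → DerAtMost h S → DerAtMost h (FS S)
  rec = DerAtMost-mapSeq h f

  framed : ∀ G {K S} → S ≈ (G ++ K) → FS S ≈ (FS G ++ FS K)
  framed G S≈ = ≈-trans (mapSeq-resp-≈ f S≈) (≡⇒≈ (map-++ (mapComp f) G _))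

  unframed : ∀ G {K} → DerAtMost h (FS (G ++ K)) → DerAtMost h (FS G ++ FS K)
  unframed G = DerAtMost-resp-≡ (sym (map-++ (mapComp f) G _))

  mapStep : ∀ {S} → Step h S → Step h (FS S)
  mapStep (step (axiom (id₁ G Γ Δ H p as)) S≈ []) =
    step (axiom (id₁ (FS G) (Fs Γ) (Fs Δ) (FS H) p (map f as)))
      (≈-trans (framed G S≈) (≡⇒≈ (cong (λ B → FS G ++ (B ∷ Fs Γ , B ∷ Fs Δ) ∷ FS H) (mapFm-patom f p as)))) []
  mapStep (step (axiom (id₂ G Γ₁ Δ₁ H Γ₂ Δ₂ K p as)) S≈ []) =
    step (axiom (id₂ (FS G) (Fs Γ₁) (Fs Δ₁) (FS H) (Fs Γ₂) (Fs Δ₂) (FS K) p (map f as)))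
      (≈-trans (framed G S≈) (≡⇒≈ (trans (cong (λ T → FS G ++ _ ∷ T) (map-++ (mapComp f) H _))
        (cong (λ B → FS G ++ (B ∷ Fs Γ₁ , Fs Δ₁) ∷ FS H ++ (Fs Γ₂ , B ∷ Fs Δ₂) ∷ FS K) (mapFm-patom f p as))))) []
  mapStep (step (axiom (⊥l G Γ Δ H)) S≈ []) =
    step (axiom (⊥l (FS G) (Fs Γ) (Fs Δ) (FS H))) (framed G S≈) []
  mapStep (step (unary (∧l G Γ Δ H A B)) S≈ (D ∷ [])) =
    step (unary (∧l (FS G) (Fs Γ) (Fs Δ) (FS H) (F A) (F B))) (framed G S≈) (unframed G (rec D) ∷ [])
  mapStep (step (unary (∨r G Γ Δ H A B)) S≈ (D ∷ [])) =
    step (unary (∨r (FS G) (Fs Γ) (Fs Δ) (FS H) (F A) (F B))) (framed G S≈) (unframed G (rec D) ∷ [])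
  mapStep (step (unary (⊃r₁ G Γ Δ A B)) S≈ (D ∷ [])) =
    step (unary (⊃r₁ (FS G) (Fs Γ) (Fs Δ) (F A) (F B))) (framed G S≈) (unframed G (rec D) ∷ [])
  mapStep (step (unary (lift G Γ₁ Δ₁ Γ₂ Δ₂ H A)) S≈ (D ∷ [])) =
    step (unary (lift (FS G) (Fs Γ₁) (Fs Δ₁) (Fs Γ₂) (Fs Δ₂) (FS H) (F A))) (framed G S≈) (unframed G (rec D) ∷ [])
  mapStep (step (unary (∀l G Γ Δ H x A a)) S≈ (D ∷ [])) =
    step (unary (∀l (FS G) (Fs Γ) (Fs Δ) (FS H) x (F A) (f a))) (framed G S≈)
      (DerAtMost-resp-≡ (cong (λ B → FS G ++ (B ∷ ∀' x (F A) ∷ Fs Γ , Fs Δ) ∷ FS H) (sym (mapFm-subst f a x A)))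
        (unframed G (rec D)) ∷ [])
  mapStep (step (unary (∃r G Γ Δ H x A a)) S≈ (D ∷ [])) =
    step (unary (∃r (FS G) (Fs Γ) (Fs Δ) (FS H) x (F A) (f a))) (framed G S≈)
      (DerAtMost-resp-≡ (cong (λ B → FS G ++ (Fs Γ , B ∷ ∃' x (F A) ∷ Fs Δ) ∷ FS H) (sym (mapFm-subst f a x A)))
        (unframed G (rec D)) ∷ [])
  mapStep (step (unary (∃l G Γ Δ H x A a a∉)) S≈ (D ∷ [])) =
    step (unary (∃l (FS G) (Fs Γ) (Fs Δ) (FS H) x (F A) e e∉)) (framed G S≈)
      (DerAtMost-resp-≡ (sym (mapSeq-∃l-premise f G Γ Δ H x A a a∉)) (DerAtMost-mapSeq h (f [ a ↦ e ]) D) ∷ [])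
    where
    e = fresh (parsS (FS (G ++ (∃' x A ∷ Γ , Δ) ∷ H)))
    e∉ = ≡.subst (λ T → e ∉ parsS T) (map-++ (mapComp f) G _) (fresh-∉ _)
  mapStep (step (unary (∀r₁ G Γ Δ x A a a∉)) S≈ (D ∷ [])) =
    step (unary (∀r₁ (FS G) (Fs Γ) (Fs Δ) x (F A) e e∉)) (framed G S≈)
      (DerAtMost-resp-≡ (sym (mapSeq-∀r₁-premise f G Γ Δ x A a a∉)) (DerAtMost-mapSeq h (f [ a ↦ e ]) D) ∷ [])
    where
    e = fresh (parsS (FS (G ++ (Γ , ∀' x A ∷ Δ) ∷ [])))
    e∉ = ≡.subst (λ T → e ∉ parsS T) (map-++ (mapComp f) G _) (fresh-∉ _)
  mapStep (step (binary (∧r G Γ Δ H A B)) S≈ (D₁ ∷ D₂ ∷ [])) =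
    step (binary (∧r (FS G) (Fs Γ) (Fs Δ) (FS H) (F A) (F B))) (framed G S≈)
      (unframed G (rec D₁) ∷ unframed G (rec D₂) ∷ [])
  mapStep (step (binary (∨l G Γ Δ H A B)) S≈ (D₁ ∷ D₂ ∷ [])) =
    step (binary (∨l (FS G) (Fs Γ) (Fs Δ) (FS H) (F A) (F B))) (framed G S≈)
      (unframed G (rec D₁) ∷ unframed G (rec D₂) ∷ [])
  mapStep (step (binary (⊃l G Γ Δ H A B)) S≈ (D₁ ∷ D₂ ∷ [])) =
    step (binary (⊃l (FS G) (Fs Γ) (Fs Δ) (FS H) (F A) (F B))) (framed G S≈)
      (unframed G (rec D₁) ∷ unframed G (rec D₂) ∷ [])
  mapStep (step (binary (⊃r₂ G Γ₁ Δ₁ Γ₂ Δ₂ H A B)) S≈ (D₁ ∷ D₂ ∷ [])) =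
    step (binary (⊃r₂ (FS G) (Fs Γ₁) (Fs Δ₁) (Fs Γ₂) (Fs Δ₂) (FS H) (F A) (F B))) (framed G S≈)
      (unframed G (rec D₁) ∷ unframed G (rec D₂) ∷ [])
  mapStep (step (binary (∀r₂ G Γ₁ Δ₁ Γ₂ Δ₂ H x A a a∉)) S≈ (D₁ ∷ D₂ ∷ [])) =
    step (binary (∀r₂ (FS G) (Fs Γ₁) (Fs Δ₁) (Fs Γ₂) (Fs Δ₂) (FS H) x (F A) e e∉)) (framed G S≈)
      (DerAtMost-resp-≡ (sym (mapSeq-∀r₂-premise f G Γ₁ Δ₁ Γ₂ Δ₂ H x A a a∉))
         (DerAtMost-mapSeq h (f [ a ↦ e ]) D₁)
       ∷ unframed G (rec D₂) ∷ [])
    where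
    e = fresh (parsS (FS (G ++ (Γ₁ , ∀' x A ∷ Δ₁) ∷ (Γ₂ , Δ₂) ∷ H)))
    e∉ = ≡.subst (λ T → e ∉ parsS T) (map-++ (mapComp f) G _) (fresh-∉ _)

rename-eigen-∃l : ∀ {h} G Γ Δ H x A a e → a ∉ parsS (G ++ (∃' x A ∷ Γ , Δ) ∷ H) →
  DerAtMost h (G ++ (subst a x A ∷ Γ , Δ) ∷ H) → DerAtMost h (G ++ (subst e x A ∷ Γ , Δ) ∷ H)
rename-eigen-∃l {h} G Γ Δ H x A a e a∉ D =
  DerAtMost-resp-≡
    (sym (trans (mapSeq-∃l-premise id G Γ Δ H x A a a∉)
      (cong-component (mapSeq-id G) (cong₂ _∷_ (cong (subst e x) (mapFm-id A)) (map-mapFm-id Γ))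
        (map-mapFm-id Δ) (mapSeq-id H))))
    (DerAtMost-mapSeq h (id [ a ↦ e ]) D)

rename-eigen-∀r₁ : ∀ {h} G Γ Δ x A a e → a ∉ parsS (G ++ (Γ , ∀' x A ∷ Δ) ∷ []) →
  DerAtMost h (G ++ (Γ , Δ) ∷ ([] , subst a x A ∷ []) ∷ []) → DerAtMost h (G ++ (Γ , Δ) ∷ ([] , subst e x A ∷ []) ∷ [])
rename-eigen-∀r₁ {h} G Γ Δ x A a e a∉ D =
  DerAtMost-resp-≡
    (sym (trans (mapSeq-∀r₁-premise id G Γ Δ x A a a∉)
      (cong-component (mapSeq-id G) (map-mapFm-id Γ) (map-mapFm-id Δ)
        (cong (λ B → ([] , subst e x B ∷ []) ∷ []) (mapFm-id A)))))
    (DerAtMost-mapSeq h (id [ a ↦ e ]) D)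

rename-eigen-∀r₂ : ∀ {h} G Γ₁ Δ₁ Γ₂ Δ₂ H x A a e → a ∉ parsS (G ++ (Γ₁ , ∀' x A ∷ Δ₁) ∷ (Γ₂ , Δ₂) ∷ H) →
  DerAtMost h (G ++ (Γ₁ , Δ₁) ∷ ([] , subst a x A ∷ []) ∷ (Γ₂ , Δ₂) ∷ H) →
  DerAtMost h (G ++ (Γ₁ , Δ₁) ∷ ([] , subst e x A ∷ []) ∷ (Γ₂ , Δ₂) ∷ H)
rename-eigen-∀r₂ {h} G Γ₁ Δ₁ Γ₂ Δ₂ H x A a e a∉ D =
  DerAtMost-resp-≡
    (sym (trans (mapSeq-∀r₂-premise id G Γ₁ Δ₁ Γ₂ Δ₂ H x A a a∉)
      (cong-component (mapSeq-id G) (map-mapFm-id Γ₁) (map-mapFm-id Δ₁)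
        (cong₂ (λ B K → ([] , subst e x B ∷ []) ∷ K) (mapFm-id A) (mapSeq-id ((Γ₂ , Δ₂) ∷ H))))))
    (DerAtMost-mapSeq h (id [ a ↦ e ]) D)

++-assoc₃ : ∀ {A : Set} (G K M T : List A) → (G ++ K ++ M) ++ T ≡ G ++ K ++ M ++ T
++-assoc₃ G K M T = trans (++-assoc G (K ++ M) T) (cong (G ++_) (++-assoc K M T))

[]≢++∷ : ∀ {A : Set} (xs : List A) {y ys} → [] ≢ xs ++ y ∷ ys
[]≢++∷ xs eq with () ← ++-conicalʳ xs _ (sym eq)

module _ {A B : Set} (R : A → B → Set) where

  data Location (G : List A) (c : A) (H : List A) (G₀ K H₀ : List B) : Set where
    before : ∀ G' c' M → G₀ ≡ G' ++ c' ∷ M →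
             Pointwise R G G' → R c c' → Pointwise R H (M ++ K ++ H₀) → Location G c H G₀ K H₀
    inside : ∀ K₁ c' K₂ → K ≡ K₁ ++ c' ∷ K₂ →
             Pointwise R G (G₀ ++ K₁) → R c c' → Pointwise R H (K₂ ++ H₀) → Location G c H G₀ K H₀
    after  : ∀ M c' H' → H₀ ≡ M ++ c' ∷ H' →
             Pointwise R G (G₀ ++ K ++ M) → R c c' → Pointwise R H H' → Location G c H G₀ K H₀

  locate : ∀ G₀ K H₀ {G c H} → Pointwise R (G ++ c ∷ H) (G₀ ++ K ++ H₀) → Location G c H G₀ K H₀
  locate (g₀ ∷ G₀) K H₀ {[]} (r ∷ rs) = before [] g₀ G₀ refl [] r rs
  locate (g₀ ∷ G₀) K H₀ {g ∷ G} (r ∷ rs) with locate G₀ K H₀ rs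
  ... | before G' c' M refl rG rc rH = before (g₀ ∷ G') c' M refl (r ∷ rG) rc rH
  ... | inside K₁ c' K₂ eq rG rc rH  = inside K₁ c' K₂ eq (r ∷ rG) rc rH
  ... | after M c' H' eq rG rc rH    = after M c' H' eq (r ∷ rG) rc rH
  locate [] (k ∷ K) H₀ {[]} (r ∷ rs) = inside [] k K refl [] r rs
  locate [] (k ∷ K) H₀ {g ∷ G} (r ∷ rs) with locate [] K H₀ rs
  ... | before G' c' M eq _ _ _      = ⊥-elim ([]≢++∷ G' eq)
  ... | inside K₁ c' K₂ refl rG rc rH = inside (k ∷ K₁) c' K₂ refl (r ∷ rG) rc rH
  ... | after M c' H' eq rG rc rH     = after M c' H' eq (r ∷ rG) rc rH
  locate [] [] (h ∷ H₀) {[]} (r ∷ rs) = after [] h H₀ refl [] r rs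
  locate [] [] (h ∷ H₀) {g ∷ G} (r ∷ rs) with locate [] [] H₀ rs
  ... | after M c' H' refl rG rc rH  = after (h ∷ M) c' H' refl (r ∷ rG) rc rH
  ... | before G' c' M eq _ _ _      = ⊥-elim ([]≢++∷ G' eq)
  ... | inside K₁ c' K₂ eq _ _ _     = ⊥-elim ([]≢++∷ K₁ eq)

  inside-singleton : ∀ {G H : List A} {G₀ H₀ : List B} {k c'} K₁ K₂ → [ k ] ≡ K₁ ++ c' ∷ K₂ →
    Pointwise R G (G₀ ++ K₁) → Pointwise R H (K₂ ++ H₀) → c' ≡ k × Pointwise R G G₀ × Pointwise R H H₀
  inside-singleton {G₀ = G₀} [] [] refl RG RH = refl , ≡.subst (Pointwise R _) (++-identityʳ G₀) RG , RH
  inside-singleton [] (_ ∷ _) ()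
  inside-singleton (_ ∷ K₁) K₂ eq _ _ = ⊥-elim ([]≢++∷ K₁ (proj₂ (∷-injective eq)))

  inside-pair : ∀ {G H : List A} {G₀ H₀ : List B} {k₁ k₂ c'} K₁ K₂ → k₁ ∷ k₂ ∷ [] ≡ K₁ ++ c' ∷ K₂ →
    Pointwise R G (G₀ ++ K₁) → Pointwise R H (K₂ ++ H₀) →
    (c' ≡ k₁ × Pointwise R G G₀ × Pointwise R H (k₂ ∷ H₀))
    ⊎ (c' ≡ k₂ × Pointwise R G (G₀ ++ [ k₁ ]) × Pointwise R H H₀)
  inside-pair {G₀ = G₀} [] (_ ∷ []) refl RG RH = inj₁ (refl , ≡.subst (Pointwise R _) (++-identityʳ G₀) RG , RH)
  inside-pair (_ ∷ []) [] refl RG RH = inj₂ (refl , RG , RH)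
  inside-pair [] [] ()
  inside-pair [] (_ ∷ _ ∷ _) ()
  inside-pair (_ ∷ []) (_ ∷ _) ()
  inside-pair (_ ∷ _ ∷ K₁) K₂ eq _ _ = ⊥-elim ([]≢++∷ K₁ (proj₂ (∷-injective (proj₂ (∷-injective eq)))))

data Splits {A : Set} (xs : List A) (y : A) (zs xs' : List A) (y' : A) (zs' : List A) : Set where
  earlier : ∀ N → xs ≡ xs' ++ y' ∷ N → zs' ≡ N ++ y ∷ zs → Splits xs y zs xs' y' zs'
  same    : xs ≡ xs' → y ≡ y' → zs ≡ zs' → Splits xs y zs xs' y' zs'
  later   : ∀ N → xs' ≡ xs ++ y ∷ N → zs ≡ N ++ y' ∷ zs' → Splits xs y zs xs' y' zs'

compare-splits : ∀ {A : Set} (xs : List A) y zs xs' y' zs' → xs ++ y ∷ zs ≡ xs' ++ y' ∷ zs' → Splits xs y zs xs' y' zs'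
compare-splits []       y zs []         y' zs' refl = same refl refl refl
compare-splits []       y zs (_ ∷ xs')  y' zs' refl = later xs' refl refl
compare-splits (_ ∷ xs) y zs []         y' zs' refl = earlier xs refl refl
compare-splits (x ∷ xs) y zs (_ ∷ xs')  y' zs' eq with refl , eq' ← ∷-injective eq with compare-splits xs y zs xs' y' zs' eq'
... | earlier N p q = earlier N (cong (x ∷_) p) q
... | same p q r    = same (cong (x ∷_) p) q r
... | later N p q   = later N (cong (x ∷_) p) q

-- Height-preserving inversion of a succedent formula

-- (G , Γ , H) stands for G // Γ ⊢ □ // H, a sequent with a hole for one succedent.
Ctx : Set
Ctx = LNS × List Fm × LNS

plug : Ctx → List Fm → LNS
plug (G , Γ , H) Θ = G ++ (Γ , Θ) ∷ H

_≈κ_ : Ctx → Ctx → Set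
(G , Γ , H) ≈κ (G' , Γ' , H') = G ≈ G' × Γ ↭ Γ' × H ≈ H'

≈κ-refl : ∀ {κ} → κ ≈κ κ
≈κ-refl = ≈-refl , ↭-refl , ≈-refl

plug-resp : ∀ {κ κ' Θ Θ'} → κ ≈κ κ' → Θ ↭ Θ' → plug κ Θ ≈ plug κ' Θ'
plug-resp (G≈ , Γ↭ , H≈) Θ↭ = Pointwise.++⁺ G≈ ((Γ↭ , Θ↭) ∷ H≈)

SuccedentFrame : (List Fm → LNS) → Set
SuccedentFrame F = ∃₂ λ κ R → ∀ Θ → F Θ ≈ plug κ (R ++ Θ)

plug-frame : ∀ κ R → SuccedentFrame (λ Θ → plug κ (R ++ Θ))
plug-frame κ R = κ , R , λ _ → ≈-refl

frame-after : ∀ G K Γ H R → SuccedentFrame (λ Θ → G ++ K ++ (Γ , R ++ Θ) ∷ H)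
frame-after G K Γ H R = (G ++ K , Γ , H) , R , λ _ → ≡⇒≈ (sym (++-assoc G K _))

record SideCondition : Set₁ where
  field
    holds : LNS → Set
    resp  : ∀ {S S'} → S ≈ S' → holds S → holds S'

open SideCondition

none : SideCondition
none = record { holds = λ _ → ⊤ ; resp = λ _ _ → tt }

avoids : ℕ → SideCondition
avoids e = record { holds = λ S → e ∉ parsS S ; resp = λ S≈S' e∉ → e∉ ∘ parsS-resp-≈ (≈-sym S≈S') }

infixr 6 _⊕_

_⊕_ : Comp → Comp → Comp
(L , R) ⊕ (Γ , Δ) = L ++ Γ , R ++ Δ

ContextualRule : SideCondition → Comp → List Comp → Set
ContextualRule sc c ps = ∀ G Γ Δ H → holds sc (G ++ c ⊕ (Γ , Δ) ∷ H) →
  Rule (map (λ p → G ++ p ⊕ (Γ , Δ) ∷ H) ps) (G ++ c ⊕ (Γ , Δ) ∷ H)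

-- Stated up to ≈ so that it applies to premises, in which X may sit anywhere in its multiset.
Invertible : Fm → List Fm → ℕ → Set
Invertible X Ys h = ∀ {S} κ Δ → S ≈ plug κ (X ∷ Δ) → DerAtMost h S → DerAtMost h (plug κ (Ys ++ Δ))

record PrincipalCases (X : Fm) (Ys : List Fm) : Set where
  field
    not-atomic     : ∀ {p as} → X ≢ patom p as
    not-⊃          : ∀ {A B} → X ≢ (A ⊃ B)
    not-∀          : ∀ {x A} → X ≢ ∀' x A
    principal-∧r   : ∀ {m κ Δ A B} → X ≡ A ∧' B →
                     DerAtMost m (plug κ (A ∷ Δ)) → DerAtMost m (plug κ (B ∷ Δ)) → DerAtMost (suc m) (plug κ (Ys ++ Δ))
    principal-∨r   : ∀ {m κ Δ A B} → X ≡ A ∨' B →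
                     DerAtMost m (plug κ (A ∷ B ∷ Δ)) → DerAtMost (suc m) (plug κ (Ys ++ Δ))
    principal-∃r   : ∀ {m κ Δ x A a} → Invertible X Ys m → X ≡ ∃' x A →
                     DerAtMost m (plug κ (subst a x A ∷ ∃' x A ∷ Δ)) → DerAtMost (suc m) (plug κ (Ys ++ Δ))

module InversionStep {X : Fm} {Ys : List Fm} (pc : PrincipalCases X Ys) {m : ℕ} (ih : Invertible X Ys m) where
  open PrincipalCases pc

  -- The rule is parametric in the multiset Θ₀ ↭ X ∷ Θ: invert every premise by the inductive
  -- hypothesis and apply the rule again at Ys ++ Θ.
  replace-in-frame : ∀ sc {I : Set} (is : List I) (P : I → List Fm → LNS) (C : List Fm → LNS) →
    All (SuccedentFrame ∘ P) is → (∀ Θ → holds sc (C Θ) → Rule (map (λ i → P i Θ) is) (C Θ)) →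
    ∀ {Θ₀ Θ S} → All (DerAtMost m) (map (λ i → P i Θ₀) is) → Θ₀ ↭ X ∷ Θ →
    S ≈ C (Ys ++ Θ) → holds sc S → DerAtMost (suc m) S
  replace-in-frame sc is P C frames rule {Θ₀} {Θ} Ds Θ₀↭ S≈ ok =
    infer (step (rule (Ys ++ Θ) (resp sc S≈ ok)) S≈ (All.map⁺ (All.zipWith replace (frames , All.map⁻ Ds))))
    where
    replace : ∀ {i} → SuccedentFrame (P i) × DerAtMost m (P i Θ₀) → DerAtMost m (P i (Ys ++ Θ))
    replace ((κ , R , shape) , D) =
      DerAtMost-resp-≈ (≈-trans (shape (Ys ++ Θ)) (plug-resp ≈κ-refl (shifts R Ys)))
        (ih κ (R ++ Θ) (≈-trans (shape Θ₀) (plug-resp ≈κ-refl (↭-trans (++⁺ˡ R Θ₀↭) (shift X R Θ)))) D)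

  replace-in-frames : ∀ sc (Ps : List (List Fm → LNS)) (C : List Fm → LNS) →
    All SuccedentFrame Ps → (∀ Θ → holds sc (C Θ) → Rule (map (λ P → P Θ) Ps) (C Θ)) →
    ∀ {Θ₀ Θ S} → All (DerAtMost m) (map (λ P → P Θ₀) Ps) → Θ₀ ↭ X ∷ Θ →
    S ≈ C (Ys ++ Θ) → holds sc S → DerAtMost (suc m) S
  replace-in-frames sc Ps = replace-in-frame sc Ps (λ P → P)

  passive-before : ∀ sc {I : Set} (is : List I) (window : I → LNS) (Kc H₀ : LNS) →
    (∀ G → holds sc (G ++ Kc ++ H₀) → Rule (map (λ i → G ++ window i ++ H₀) is) (G ++ Kc ++ H₀)) →
    ∀ G' Γ' Δ' M → All (DerAtMost m) (map (λ i → (G' ++ (Γ' , Δ') ∷ M) ++ window i ++ H₀) is) →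
    ∀ {κ Δ} → κ ≈κ (G' , Γ' , M ++ Kc ++ H₀) → Δ' ↭ X ∷ Δ → holds sc (plug κ (Ys ++ Δ)) →
    DerAtMost (suc m) (plug κ (Ys ++ Δ))
  passive-before sc is window Kc H₀ rule G' Γ' Δ' M Ds {κ} {Δ} κ≈ Δ'↭ ok =
    replace-in-frame sc is P C frames (λ Θ → rule (G' ++ (Γ' , Θ) ∷ M)) Ds Δ'↭ target≈ ok
    where
    P : _ → List Fm → LNS
    P i Θ = (G' ++ (Γ' , Θ) ∷ M) ++ window i ++ H₀
    C : List Fm → LNS
    C Θ = (G' ++ (Γ' , Θ) ∷ M) ++ Kc ++ H₀
    frames : All (SuccedentFrame ∘ P) is
    frames = All.tabulate λ {i} _ → (G' , Γ' , M ++ window i ++ H₀) , [] , λ Θ → ≡⇒≈ (++-assoc G' _ _)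
    target≈ : plug κ (Ys ++ Δ) ≈ C (Ys ++ Δ)
    target≈ = ≈-trans (plug-resp κ≈ ↭-refl) (≡⇒≈ (sym (++-assoc G' _ _)))

  passive-after : ∀ sc {I : Set} (is : List I) (window : I → LNS) (G₀ Kc : LNS) →
    (∀ H → holds sc (G₀ ++ Kc ++ H) → Rule (map (λ i → G₀ ++ window i ++ H) is) (G₀ ++ Kc ++ H)) →
    ∀ M Γ' Δ' H' → All (DerAtMost m) (map (λ i → G₀ ++ window i ++ M ++ (Γ' , Δ') ∷ H') is) →
    ∀ {κ Δ} → κ ≈κ (G₀ ++ Kc ++ M , Γ' , H') → Δ' ↭ X ∷ Δ → holds sc (plug κ (Ys ++ Δ)) →
    DerAtMost (suc m) (plug κ (Ys ++ Δ))
  passive-after sc is window G₀ Kc rule M Γ' Δ' H' Ds {κ} {Δ} κ≈ Δ'↭ ok =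
    replace-in-frame sc is P C frames (λ Θ → rule (M ++ (Γ' , Θ) ∷ H')) Ds Δ'↭ target≈ ok
    where
    P : _ → List Fm → LNS
    P i Θ = G₀ ++ window i ++ M ++ (Γ' , Θ) ∷ H'
    C : List Fm → LNS
    C Θ = G₀ ++ Kc ++ M ++ (Γ' , Θ) ∷ H'
    frames : All (SuccedentFrame ∘ P) is
    frames = All.tabulate λ {i} _ → (G₀ ++ window i ++ M , Γ' , H') , [] , λ Θ → ≡⇒≈ (sym (++-assoc₃ G₀ (window i) M _))
    target≈ : plug κ (Ys ++ Δ) ≈ C (Ys ++ Δ)
    target≈ = ≈-trans (plug-resp κ≈ ↭-refl) (≡⇒≈ (++-assoc₃ G₀ Kc M _))

  contextual-case : ∀ sc c ps → ContextualRule sc c ps → ∀ G₀ Γ₀ Δ₀ H₀ →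
    All (DerAtMost m) (map (λ p → G₀ ++ p ⊕ (Γ₀ , Δ₀) ∷ H₀) ps) →
    ∀ {κ Δ} → plug κ (X ∷ Δ) ≈ (G₀ ++ c ⊕ (Γ₀ , Δ₀) ∷ H₀) → holds sc (plug κ (Ys ++ Δ)) →
    (∀ {R'} → proj₂ c ↭ X ∷ R' → κ ≈κ (G₀ , proj₁ c ++ Γ₀ , H₀) → Δ ↭ R' ++ Δ₀ →
       DerAtMost (suc m) (plug κ (Ys ++ Δ))) →
    DerAtMost (suc m) (plug κ (Ys ++ Δ))
  contextual-case sc c ps rule G₀ Γ₀ Δ₀ H₀ Ds {G , Γ , H} {Δ} t ok principal
    with locate _≈c_ G₀ [ c ⊕ (Γ₀ , Δ₀) ] H₀ t
  ... | before G' (Γ' , Δ') M refl G≈ (Γ↭ , Δ↭) H≈ =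
    passive-before sc ps (λ p → [ p ⊕ (Γ₀ , Δ₀) ]) [ c ⊕ (Γ₀ , Δ₀) ] H₀ (λ G → rule G Γ₀ Δ₀ H₀)
      G' Γ' Δ' M Ds (G≈ , Γ↭ , H≈) (↭-sym Δ↭) ok
  ... | after M (Γ' , Δ') H' refl G≈ (Γ↭ , Δ↭) H≈ =
    passive-after sc ps (λ p → [ p ⊕ (Γ₀ , Δ₀) ]) G₀ [ c ⊕ (Γ₀ , Δ₀) ] (λ H → rule G₀ Γ₀ Δ₀ H)
      M Γ' Δ' H' Ds (G≈ , Γ↭ , H≈) (↭-sym Δ↭) ok
  ... | inside K₁ c' K₂ eq G≈ c≈ H≈ with inside-singleton _≈c_ K₁ K₂ eq G≈ H≈
  ...   | refl , G≈₀ , H≈₀ with ∷↭++ (proj₂ c) (proj₂ c≈)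
  ...     | inj₁ (R' , c↭ , Δ↭) = principal c↭ (G≈₀ , proj₁ c≈ , H≈₀) Δ↭
  ...     | inj₂ (Θ , Δ₀↭ , Δ↭) =
    replace-in-frame sc ps P C frames (λ Θ → rule G₀ Γ₀ Θ H₀) Ds Δ₀↭ target≈ ok
    where
    P : Comp → List Fm → LNS
    P p Θ = G₀ ++ p ⊕ (Γ₀ , Θ) ∷ H₀
    C : List Fm → LNS
    C Θ = G₀ ++ c ⊕ (Γ₀ , Θ) ∷ H₀
    frames : All (SuccedentFrame ∘ P) ps
    frames = All.tabulate λ {p} _ → plug-frame (G₀ , proj₁ p ++ Γ₀ , H₀) (proj₂ p)
    target≈ : plug (G , Γ , H) (Ys ++ Δ) ≈ C (Ys ++ Θ)
    target≈ = plug-resp (G≈₀ , proj₁ c≈ , H≈₀) (↭-trans (++⁺ˡ Ys Δ↭) (shifts Ys (proj₂ c)))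

  adjacent : ∀ sc {I : Set} (is : List I) (window : I → LNS) (k₁ k₂ : Comp) G₀ H₀ →
    (∀ G H → holds sc (G ++ k₁ ∷ k₂ ∷ H) → Rule (map (λ i → G ++ window i ++ H) is) (G ++ k₁ ∷ k₂ ∷ H)) →
    All (DerAtMost m) (map (λ i → G₀ ++ window i ++ H₀) is) →
    ∀ {κ Δ} → plug κ (X ∷ Δ) ≈ (G₀ ++ k₁ ∷ k₂ ∷ H₀) → holds sc (plug κ (Ys ++ Δ)) →
    (κ ≈κ (G₀ , proj₁ k₁ , k₂ ∷ H₀) → X ∷ Δ ↭ proj₂ k₁ → DerAtMost (suc m) (plug κ (Ys ++ Δ))) →
    (κ ≈κ (G₀ ++ [ k₁ ] , proj₁ k₂ , H₀) → X ∷ Δ ↭ proj₂ k₂ → DerAtMost (suc m) (plug κ (Ys ++ Δ))) →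
    DerAtMost (suc m) (plug κ (Ys ++ Δ))
  adjacent sc is window k₁ k₂ G₀ H₀ rule Ds {G , Γ , H} t ok first second
    with locate _≈c_ G₀ (k₁ ∷ k₂ ∷ []) H₀ t
  ... | before G' (Γ' , Δ') M refl G≈ (Γ↭ , Δ↭) H≈ =
    passive-before sc is window (k₁ ∷ k₂ ∷ []) H₀ (λ G → rule G H₀) G' Γ' Δ' M Ds (G≈ , Γ↭ , H≈) (↭-sym Δ↭) ok
  ... | after M (Γ' , Δ') H' refl G≈ (Γ↭ , Δ↭) H≈ =
    passive-after sc is window G₀ (k₁ ∷ k₂ ∷ []) (rule G₀) M Γ' Δ' H' Ds (G≈ , Γ↭ , H≈) (↭-sym Δ↭) ok
  ... | inside K₁ c' K₂ eq G≈ (Γ↭ , Δ↭) H≈ with inside-pair _≈c_ K₁ K₂ eq G≈ H≈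
  ...   | inj₁ (refl , G≈₀ , H≈₀) = first (G≈₀ , Γ↭ , H≈₀) Δ↭
  ...   | inj₂ (refl , G≈₀ , H≈₀) = second (G≈₀ , Γ↭ , H≈₀) Δ↭

  lift-case : ∀ G₀ Γ₁ Δ₁ Γ₂ Δ₂ H₀ A → DerAtMost m (G₀ ++ (A ∷ Γ₁ , Δ₁) ∷ (A ∷ Γ₂ , Δ₂) ∷ H₀) →
    ∀ {κ Δ} → plug κ (X ∷ Δ) ≈ (G₀ ++ (A ∷ Γ₁ , Δ₁) ∷ (Γ₂ , Δ₂) ∷ H₀) → DerAtMost (suc m) (plug κ (Ys ++ Δ))
  lift-case G₀ Γ₁ Δ₁ Γ₂ Δ₂ H₀ A D t =
    adjacent none [ (A ∷ Γ₁ , Δ₁) ∷ (A ∷ Γ₂ , Δ₂) ∷ [] ] id (A ∷ Γ₁ , Δ₁) (Γ₂ , Δ₂) G₀ H₀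
      (λ G H _ → unary (lift G Γ₁ Δ₁ Γ₂ Δ₂ H A)) (D ∷ []) t tt
      (λ κ≈ Δ₁↭ → replace-in-frames none
         [ (λ Θ → G₀ ++ (A ∷ Γ₁ , Θ) ∷ (A ∷ Γ₂ , Δ₂) ∷ H₀) ] (λ Θ → G₀ ++ (A ∷ Γ₁ , Θ) ∷ (Γ₂ , Δ₂) ∷ H₀)
         (plug-frame (G₀ , A ∷ Γ₁ , (A ∷ Γ₂ , Δ₂) ∷ H₀) [] ∷ []) (λ Θ _ → unary (lift G₀ Γ₁ Θ Γ₂ Δ₂ H₀ A))
         (D ∷ []) (↭-sym Δ₁↭) (plug-resp κ≈ ↭-refl) tt)
      (λ κ≈ Δ₂↭ → replace-in-frames none
         [ (λ Θ → G₀ ++ (A ∷ Γ₁ , Δ₁) ∷ (A ∷ Γ₂ , Θ) ∷ H₀) ] (λ Θ → G₀ ++ (A ∷ Γ₁ , Δ₁) ∷ (Γ₂ , Θ) ∷ H₀)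
         (frame-after G₀ [ (A ∷ Γ₁ , Δ₁) ] (A ∷ Γ₂) H₀ [] ∷ []) (λ Θ _ → unary (lift G₀ Γ₁ Δ₁ Γ₂ Θ H₀ A))
         (D ∷ []) (↭-sym Δ₂↭) (≈-trans (plug-resp κ≈ ↭-refl) (≡⇒≈ (++-assoc G₀ _ _))) tt)

  r₂-case : ∀ sc (N : Comp) (R : Fm) → X ≢ R →
    (∀ G Γ₁ Δ₁ Γ₂ Δ₂ H → holds sc (G ++ (Γ₁ , R ∷ Δ₁) ∷ (Γ₂ , Δ₂) ∷ H) →
      Rule ((G ++ (Γ₁ , Δ₁) ∷ N ∷ (Γ₂ , Δ₂) ∷ H) ∷ (G ++ (Γ₁ , Δ₁) ∷ (Γ₂ , R ∷ Δ₂) ∷ H) ∷ [])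
           (G ++ (Γ₁ , R ∷ Δ₁) ∷ (Γ₂ , Δ₂) ∷ H)) →
    ∀ G₀ Γ₁ Δ₁ Γ₂ Δ₂ H₀ → DerAtMost m (G₀ ++ (Γ₁ , Δ₁) ∷ N ∷ (Γ₂ , Δ₂) ∷ H₀) →
    DerAtMost m (G₀ ++ (Γ₁ , Δ₁) ∷ (Γ₂ , R ∷ Δ₂) ∷ H₀) →
    ∀ {κ Δ} → plug κ (X ∷ Δ) ≈ (G₀ ++ (Γ₁ , R ∷ Δ₁) ∷ (Γ₂ , Δ₂) ∷ H₀) → holds sc (plug κ (Ys ++ Δ)) →
    DerAtMost (suc m) (plug κ (Ys ++ Δ))
  r₂-case sc N R X≢R rule G₀ Γ₁ Δ₁ Γ₂ Δ₂ H₀ D₁ D₂ {κ} {Δ} t ok =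
    adjacent sc (((Γ₁ , Δ₁) ∷ N ∷ (Γ₂ , Δ₂) ∷ []) ∷ ((Γ₁ , Δ₁) ∷ (Γ₂ , R ∷ Δ₂) ∷ []) ∷ []) id
      (Γ₁ , R ∷ Δ₁) (Γ₂ , Δ₂) G₀ H₀ (λ G H → rule G Γ₁ Δ₁ Γ₂ Δ₂ H) (D₁ ∷ D₂ ∷ []) t ok first second
    where
    first : κ ≈κ (G₀ , Γ₁ , (Γ₂ , Δ₂) ∷ H₀) → X ∷ Δ ↭ R ∷ Δ₁ → DerAtMost (suc m) (plug κ (Ys ++ Δ))
    first κ≈ X∷Δ↭ with ∷↭++ [ R ] X∷Δ↭
    ... | inj₁ (_ , R↭ , _) = ⊥-elim (X≢R (↭-[-]-∷ R↭))
    ... | inj₂ (Θ , Δ₁↭ , Δ↭) = replace-in-frames sc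
      ((λ Θ → G₀ ++ (Γ₁ , Θ) ∷ N ∷ (Γ₂ , Δ₂) ∷ H₀) ∷ (λ Θ → G₀ ++ (Γ₁ , Θ) ∷ (Γ₂ , R ∷ Δ₂) ∷ H₀) ∷ [])
      (λ Θ → G₀ ++ (Γ₁ , R ∷ Θ) ∷ (Γ₂ , Δ₂) ∷ H₀)
      (plug-frame (G₀ , Γ₁ , N ∷ (Γ₂ , Δ₂) ∷ H₀) [] ∷ plug-frame (G₀ , Γ₁ , (Γ₂ , R ∷ Δ₂) ∷ H₀) [] ∷ [])
      (λ Θ → rule G₀ Γ₁ Θ Γ₂ Δ₂ H₀) (D₁ ∷ D₂ ∷ []) Δ₁↭
      (plug-resp κ≈ (↭-trans (++⁺ˡ Ys Δ↭) (shift R Ys Θ))) ok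
    second : κ ≈κ (G₀ ++ [ (Γ₁ , R ∷ Δ₁) ] , Γ₂ , H₀) → X ∷ Δ ↭ Δ₂ → DerAtMost (suc m) (plug κ (Ys ++ Δ))
    second κ≈ Δ₂↭ = replace-in-frames sc
      ((λ Θ → G₀ ++ (Γ₁ , Δ₁) ∷ N ∷ (Γ₂ , Θ) ∷ H₀) ∷ (λ Θ → G₀ ++ (Γ₁ , Δ₁) ∷ (Γ₂ , R ∷ Θ) ∷ H₀) ∷ [])
      (λ Θ → G₀ ++ (Γ₁ , R ∷ Δ₁) ∷ (Γ₂ , Θ) ∷ H₀)
      (frame-after G₀ ((Γ₁ , Δ₁) ∷ N ∷ []) Γ₂ H₀ [] ∷ frame-after G₀ [ (Γ₁ , Δ₁) ] Γ₂ H₀ [ R ] ∷ [])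
      (λ Θ → rule G₀ Γ₁ Δ₁ Γ₂ Θ H₀) (D₁ ∷ D₂ ∷ []) (↭-sym Δ₂↭)
      (≈-trans (plug-resp κ≈ ↭-refl) (≡⇒≈ (++-assoc G₀ _ _))) ok

  r₁-case : ∀ sc (N : Comp) (R : Fm) → X ≢ R →
    (∀ G Γ Δ → holds sc (G ++ (Γ , R ∷ Δ) ∷ []) → Rule [ G ++ (Γ , Δ) ∷ N ∷ [] ] (G ++ (Γ , R ∷ Δ) ∷ [])) →
    ∀ G₀ Γ₀ Δ₀ → DerAtMost m (G₀ ++ (Γ₀ , Δ₀) ∷ N ∷ []) →
    ∀ {κ Δ} → plug κ (X ∷ Δ) ≈ (G₀ ++ (Γ₀ , R ∷ Δ₀) ∷ []) → holds sc (plug κ (Ys ++ Δ)) →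
    DerAtMost (suc m) (plug κ (Ys ++ Δ))
  r₁-case sc N R X≢R rule G₀ Γ₀ Δ₀ D {G , Γ , H} t ok with locate _≈c_ G₀ [ (Γ₀ , R ∷ Δ₀) ] [] t
  ... | before G' (Γ' , Δ') M refl G≈ (Γ↭ , Δ↭) H≈ =
    passive-before sc [ (Γ₀ , Δ₀) ∷ N ∷ [] ] id [ (Γ₀ , R ∷ Δ₀) ] [] (λ G → rule G Γ₀ Δ₀)
      G' Γ' Δ' M (D ∷ []) (G≈ , Γ↭ , H≈) (↭-sym Δ↭) ok
  ... | after M _ _ eq _ _ _ = ⊥-elim ([]≢++∷ M eq)
  ... | inside K₁ c' K₂ eq G≈ c≈ H≈ with inside-singleton _≈c_ K₁ K₂ eq G≈ H≈
  ...   | refl , G≈₀ , H≈₀ with ∷↭++ [ R ] (proj₂ c≈)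
  ...     | inj₁ (_ , R↭ , _) = ⊥-elim (X≢R (↭-[-]-∷ R↭))
  ...     | inj₂ (Θ , Δ₀↭ , Δ↭) = replace-in-frames sc
    [ (λ Θ → G₀ ++ (Γ₀ , Θ) ∷ N ∷ []) ] (λ Θ → G₀ ++ (Γ₀ , R ∷ Θ) ∷ [])
    (plug-frame (G₀ , Γ₀ , N ∷ []) [] ∷ []) (λ Θ → rule G₀ Γ₀ Θ) (D ∷ []) Δ₀↭
    (plug-resp (G≈₀ , proj₁ c≈ , H≈₀) (↭-trans (++⁺ˡ Ys Δ↭) (shift R Ys Θ))) ok

  axiom-at : ∀ {S C} → Inst0 C → S ≈ C → DerAtMost (suc m) S
  axiom-at i S≈ = infer (step (axiom i) S≈ [])

  id₂-case : ∀ G₀ Γ₁ Δ₁ M₀ Γ₂ Δ₂ F₀ p as {κ Δ} →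
    plug κ (X ∷ Δ) ≈ (G₀ ++ (patom p as ∷ Γ₁ , Δ₁) ∷ M₀ ++ (Γ₂ , patom p as ∷ Δ₂) ∷ F₀) →
    DerAtMost (suc m) (plug κ (Ys ++ Δ))
  id₂-case G₀ Γ₁ Δ₁ M₀ Γ₂ Δ₂ F₀ p as {G , Γ , H} {Δ} t
    with locate _≈c_ G₀ [ (patom p as ∷ Γ₁ , Δ₁) ] (M₀ ++ (Γ₂ , patom p as ∷ Δ₂) ∷ F₀) t
  ... | before G' _ M refl G≈ _ H≈ =
    axiom-at (id₂ (G' ++ (Γ , Ys ++ Δ) ∷ M) Γ₁ Δ₁ M₀ Γ₂ Δ₂ F₀ p as)
      (≈-trans (plug-resp (G≈ , ↭-refl , H≈) ↭-refl) (≡⇒≈ (sym (++-assoc G' _ _))))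
  ... | inside K₁ _ K₂ eq G≈ c≈ H≈ with inside-singleton _≈c_ K₁ K₂ eq G≈ H≈
  ...   | refl , G≈₀ , H≈₀ =
    axiom-at (id₂ G₀ Γ₁ (Ys ++ Δ) M₀ Γ₂ Δ₂ F₀ p as) (plug-resp (G≈₀ , proj₁ c≈ , H≈₀) ↭-refl)
  id₂-case G₀ Γ₁ Δ₁ M₀ Γ₂ Δ₂ F₀ p as {G , Γ , H} {Δ} t | after M c' H' eq G≈ c≈ H≈
    with compare-splits M₀ _ F₀ M c' H' eq
  ... | earlier N refl refl =
    axiom-at (id₂ G₀ Γ₁ Δ₁ (M ++ (Γ , Ys ++ Δ) ∷ N) Γ₂ Δ₂ F₀ p as)
      (≈-trans (plug-resp (G≈ , ↭-refl , H≈) ↭-refl)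
        (≡⇒≈ (trans (++-assoc G₀ _ _) (cong (λ T → G₀ ++ _ ∷ T) (sym (++-assoc M _ _))))))
  ... | later N refl refl =
    axiom-at (id₂ G₀ Γ₁ Δ₁ M₀ Γ₂ Δ₂ (N ++ (Γ , Ys ++ Δ) ∷ H') p as)
      (≈-trans (plug-resp (G≈ , ↭-refl , H≈) ↭-refl)
        (≡⇒≈ (trans (++-assoc G₀ _ _) (cong (λ T → G₀ ++ _ ∷ T) (++-assoc M₀ _ _)))))
  ... | same refl refl refl with ∷↭++ [ patom p as ] (proj₂ c≈)
  ...   | inj₁ (_ , pa↭ , _) = ⊥-elim (not-atomic (↭-[-]-∷ pa↭))
  ...   | inj₂ (Θ , _ , Δ↭) =
    axiom-at (id₂ G₀ Γ₁ Δ₁ M₀ Γ (Ys ++ Θ) F₀ p as)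
      (≈-trans (plug-resp (G≈ , ↭-refl , H≈) (↭-trans (++⁺ˡ Ys Δ↭) (shift _ Ys Θ))) (≡⇒≈ (++-assoc G₀ _ _)))

  principal : ∀ {R G₀ Γ₀ Δ₀ H₀} → (X ≡ R → DerAtMost (suc m) (plug (G₀ , Γ₀ , H₀) (Ys ++ Δ₀))) →
    ∀ {R' κ Δ} → [ R ] ↭ X ∷ R' → κ ≈κ (G₀ , Γ₀ , H₀) → Δ ↭ R' ++ Δ₀ → DerAtMost (suc m) (plug κ (Ys ++ Δ))
  principal case R↭ κ≈ Δ↭ with refl ← ↭-singleton-inv (↭-sym R↭) =
    DerAtMost-resp-≈ (plug-resp κ≈ (++⁺ˡ Ys Δ↭)) (case refl)

  no-principal : ∀ {R' κ κ₀ Δ Δ₀} → [] ↭ X ∷ R' → κ ≈κ κ₀ → Δ ↭ R' ++ Δ₀ → DerAtMost (suc m) (plug κ (Ys ++ Δ))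
  no-principal p _ _ = ⊥-elim (↭-[]-∷ p)

  by-rule : ∀ {Ps C} → Rule Ps C → All (DerAtMost m) Ps →
    ∀ {κ Δ} → plug κ (X ∷ Δ) ≈ C → DerAtMost (suc m) (plug κ (Ys ++ Δ))
  by-rule (axiom (id₁ G₀ Γ₀ Δ₀ H₀ p as)) [] t =
    contextual-case none (patom p as ∷ [] , patom p as ∷ []) [] (λ G Γ Δ H _ → axiom (id₁ G Γ Δ H p as))
      G₀ Γ₀ Δ₀ H₀ [] t tt (principal (⊥-elim ∘ not-atomic))
  by-rule (axiom (id₂ G₀ Γ₁ Δ₁ M₀ Γ₂ Δ₂ F₀ p as)) [] t = id₂-case G₀ Γ₁ Δ₁ M₀ Γ₂ Δ₂ F₀ p as t
  by-rule (axiom (⊥l G₀ Γ₀ Δ₀ H₀)) [] t =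
    contextual-case none (⊥' ∷ [] , []) [] (λ G Γ Δ H _ → axiom (⊥l G Γ Δ H)) G₀ Γ₀ Δ₀ H₀ [] t tt no-principal
  by-rule (unary (∧l G₀ Γ₀ Δ₀ H₀ A B)) Ds t =
    contextual-case none (A ∧' B ∷ [] , []) [ (A ∷ B ∷ [] , []) ] (λ G Γ Δ H _ → unary (∧l G Γ Δ H A B))
      G₀ Γ₀ Δ₀ H₀ Ds t tt no-principal
  by-rule (unary (∀l G₀ Γ₀ Δ₀ H₀ x A a)) Ds t =
    contextual-case none (∀' x A ∷ [] , []) [ (subst a x A ∷ ∀' x A ∷ [] , []) ] (λ G Γ Δ H _ → unary (∀l G Γ Δ H x A a))
      G₀ Γ₀ Δ₀ H₀ Ds t tt no-principal
  by-rule (unary (∃l G₀ Γ₀ Δ₀ H₀ x A a a∉)) (D ∷ []) {κ} {Δ} t =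
    contextual-case (avoids e) (∃' x A ∷ [] , []) [ (subst e x A ∷ [] , []) ]
      (λ G Γ Δ H e∉ → unary (∃l G Γ Δ H x A e e∉))
      G₀ Γ₀ Δ₀ H₀ (rename-eigen-∃l G₀ Γ₀ Δ₀ H₀ x A a e a∉ D ∷ []) t (fresh-∉ _) no-principal
    where e = fresh (parsS (plug κ (Ys ++ Δ)))
  by-rule (unary (∨r G₀ Γ₀ Δ₀ H₀ A B)) (D ∷ []) t =
    contextual-case none ([] , (A ∨' B) ∷ []) [ ([] , A ∷ B ∷ []) ] (λ G Γ Δ H _ → unary (∨r G Γ Δ H A B))
      G₀ Γ₀ Δ₀ H₀ (D ∷ []) t tt (principal (λ X≡ → principal-∨r {κ = G₀ , Γ₀ , H₀} X≡ D))
  by-rule (unary (∃r G₀ Γ₀ Δ₀ H₀ x A a)) (D ∷ []) t =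
    contextual-case none ([] , ∃' x A ∷ []) [ ([] , subst a x A ∷ ∃' x A ∷ []) ] (λ G Γ Δ H _ → unary (∃r G Γ Δ H x A a))
      G₀ Γ₀ Δ₀ H₀ (D ∷ []) t tt (principal (λ X≡ → principal-∃r {κ = G₀ , Γ₀ , H₀} ih X≡ D))
  by-rule (unary (⊃r₁ G₀ Γ₀ Δ₀ A B)) (D ∷ []) t =
    r₁-case none (A ∷ [] , B ∷ []) (A ⊃ B) not-⊃ (λ G Γ Δ _ → unary (⊃r₁ G Γ Δ A B)) G₀ Γ₀ Δ₀ D t tt
  by-rule (unary (∀r₁ G₀ Γ₀ Δ₀ x A a a∉)) (D ∷ []) {κ} {Δ} t =
    r₁-case (avoids e) ([] , subst e x A ∷ []) (∀' x A) not-∀ (λ G Γ Δ e∉ → unary (∀r₁ G Γ Δ x A e e∉))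
      G₀ Γ₀ Δ₀ (rename-eigen-∀r₁ G₀ Γ₀ Δ₀ x A a e a∉ D) t (fresh-∉ _)
    where e = fresh (parsS (plug κ (Ys ++ Δ)))
  by-rule (unary (lift G₀ Γ₁ Δ₁ Γ₂ Δ₂ H₀ A)) (D ∷ []) t = lift-case G₀ Γ₁ Δ₁ Γ₂ Δ₂ H₀ A D t
  by-rule (binary (∧r G₀ Γ₀ Δ₀ H₀ A B)) (D₁ ∷ D₂ ∷ []) t =
    contextual-case none ([] , A ∧' B ∷ []) (([] , A ∷ []) ∷ ([] , B ∷ []) ∷ []) (λ G Γ Δ H _ → binary (∧r G Γ Δ H A B))
      G₀ Γ₀ Δ₀ H₀ (D₁ ∷ D₂ ∷ []) t tt (principal (λ X≡ → principal-∧r {κ = G₀ , Γ₀ , H₀} X≡ D₁ D₂))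
  by-rule (binary (∨l G₀ Γ₀ Δ₀ H₀ A B)) Ds t =
    contextual-case none ((A ∨' B) ∷ [] , []) ((A ∷ [] , []) ∷ (B ∷ [] , []) ∷ []) (λ G Γ Δ H _ → binary (∨l G Γ Δ H A B))
      G₀ Γ₀ Δ₀ H₀ Ds t tt no-principal
  by-rule (binary (⊃l G₀ Γ₀ Δ₀ H₀ A B)) Ds t =
    contextual-case none ((A ⊃ B) ∷ [] , []) ((B ∷ [] , []) ∷ ((A ⊃ B) ∷ [] , A ∷ []) ∷ [])
      (λ G Γ Δ H _ → binary (⊃l G Γ Δ H A B)) G₀ Γ₀ Δ₀ H₀ Ds t tt no-principal
  by-rule (binary (⊃r₂ G₀ Γ₁ Δ₁ Γ₂ Δ₂ H₀ A B)) (D₁ ∷ D₂ ∷ []) t =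
    r₂-case none (A ∷ [] , B ∷ []) (A ⊃ B) not-⊃ (λ G Γ₁ Δ₁ Γ₂ Δ₂ H _ → binary (⊃r₂ G Γ₁ Δ₁ Γ₂ Δ₂ H A B))
      G₀ Γ₁ Δ₁ Γ₂ Δ₂ H₀ D₁ D₂ t tt
  by-rule (binary (∀r₂ G₀ Γ₁ Δ₁ Γ₂ Δ₂ H₀ x A a a∉)) (D₁ ∷ D₂ ∷ []) {κ} {Δ} t =
    r₂-case (avoids e) ([] , subst e x A ∷ []) (∀' x A) not-∀
      (λ G Γ₁ Δ₁ Γ₂ Δ₂ H e∉ → binary (∀r₂ G Γ₁ Δ₁ Γ₂ Δ₂ H x A e e∉))
      G₀ Γ₁ Δ₁ Γ₂ Δ₂ H₀ (rename-eigen-∀r₂ G₀ Γ₁ Δ₁ Γ₂ Δ₂ H₀ x A a e a∉ D₁) D₂ t (fresh-∉ _)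
    where e = fresh (parsS (plug κ (Ys ++ Δ)))

  invertible-suc : Invertible X Ys (suc m)
  invertible-suc κ Δ S≈ D with step rule C≈ Ds ← lastStep D = by-rule rule Ds (≈-trans (≈-sym S≈) C≈)

invertible : ∀ {X Ys} → PrincipalCases X Ys → ∀ h → Invertible X Ys h
invertible pc zero    _ _ _ (leaf _ _ , ())
invertible pc zero    _ _ _ (node₁ _ _ _ , ())
invertible pc zero    _ _ _ (node₂ _ _ _ _ , ())
invertible pc (suc h) = InversionStep.invertible-suc pc (invertible pc h)

-- Inversion of ∧r, ∨r and ∃r

∧-inversionˡ : ∀ A B → PrincipalCases (A ∧' B) [ A ]
∧-inversionˡ A B = record
  { not-atomic = λ () ; not-⊃ = λ () ; not-∀ = λ ()
  ; principal-∧r = λ { refl D _ → DerAtMost-suc D }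
  ; principal-∨r = λ () ; principal-∃r = λ _ () }

∧-inversionʳ : ∀ A B → PrincipalCases (A ∧' B) [ B ]
∧-inversionʳ A B = record
  { not-atomic = λ () ; not-⊃ = λ () ; not-∀ = λ ()
  ; principal-∧r = λ { refl _ D → DerAtMost-suc D }
  ; principal-∨r = λ () ; principal-∃r = λ _ () }

∨-inversion : ∀ A B → PrincipalCases (A ∨' B) (A ∷ B ∷ [])
∨-inversion A B = record
  { not-atomic = λ () ; not-⊃ = λ () ; not-∀ = λ ()
  ; principal-∧r = λ ()
  ; principal-∨r = λ { refl D → DerAtMost-suc D }
  ; principal-∃r = λ _ () }

∃-inversion : ∀ x A b → PrincipalCases (∃' x A) (subst b x A ∷ ∃' x A ∷ [])
∃-inversion x A b = record
  { not-atomic = λ () ; not-⊃ = λ () ; not-∀ = λ ()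
  ; principal-∧r = λ () ; principal-∨r = λ ()
  ; principal-∃r = principal }
  where
  principal : ∀ {m κ Δ y A' a} → Invertible (∃' x A) (subst b x A ∷ ∃' x A ∷ []) m → ∃' x A ≡ ∃' y A' →
    DerAtMost m (plug κ (subst a y A' ∷ ∃' y A' ∷ Δ)) → DerAtMost (suc m) (plug κ (subst b x A ∷ ∃' x A ∷ Δ))
  principal {κ = G , Γ , H} {Δ} {a = a} ih refl D =
    infer (step (unary (∃r G Γ (subst b x A ∷ Δ) H x A a)) (plug-resp ≈κ-refl (swap _ _ ↭-refl))
      (DerAtMost-resp-≈ (plug-resp ≈κ-refl reorder)
         (ih (G , Γ , H) (subst a x A ∷ Δ) (plug-resp ≈κ-refl (swap _ _ ↭-refl)) D) ∷ []))
    where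
    reorder : subst a x A ∷ ∃' x A ∷ subst b x A ∷ Δ ↭ subst b x A ∷ ∃' x A ∷ subst a x A ∷ Δ
    reorder = ↭-trans (prep _ (swap _ _ ↭-refl)) (↭-trans (swap _ _ ↭-refl) (prep _ (swap _ _ ↭-refl)))

lemma9 :
    (∀ G Γ Δ H A B → ClosedS (G ++ (Γ , (A ∧' B) ∷ Δ) ∷ H) →
      (d : Der (G ++ (Γ , (A ∧' B) ∷ Δ) ∷ H)) →
      DerAtMost (height d) (G ++ (Γ , A ∷ Δ) ∷ H)
      × DerAtMost (height d) (G ++ (Γ , B ∷ Δ) ∷ H))
    × (∀ G Γ Δ H A B → ClosedS (G ++ (Γ , (A ∨' B) ∷ Δ) ∷ H) →
      (d : Der (G ++ (Γ , (A ∨' B) ∷ Δ) ∷ H)) →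
      DerAtMost (height d) (G ++ (Γ , A ∷ B ∷ Δ) ∷ H))
    × (∀ G Γ Δ H x A a → ClosedS (G ++ (Γ , ∃' x A ∷ Δ) ∷ H) →
      (d : Der (G ++ (Γ , ∃' x A ∷ Δ) ∷ H)) →
      DerAtMost (height d) (G ++ (Γ , subst a x A ∷ ∃' x A ∷ Δ) ∷ H))
lemma9 =
    (λ G Γ Δ H A B _ d → invert (∧-inversionˡ A B) G Γ Δ H d , invert (∧-inversionʳ A B) G Γ Δ H d)
  , (λ G Γ Δ H A B _ d → invert (∨-inversion A B) G Γ Δ H d)
  , (λ G Γ Δ H x A a _ d → invert (∃-inversion x A a) G Γ Δ H d)
  where
  invert : ∀ {X Ys} → PrincipalCases X Ys → ∀ G Γ Δ H (d : Der (G ++ (Γ , X ∷ Δ) ∷ H)) →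
    DerAtMost (height d) (G ++ (Γ , Ys ++ Δ) ∷ H)
  invert pc G Γ Δ H d = invertible pc (height d) (G , Γ , H) Δ ≈-refl (d , ≤-refl)
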